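{- Every TBRSC with at most $5$ vertices is boolean representable.
   Context: A (finite) simplicial complex is a pair $S=(V,\mathcal{H})$ where $V$ is a finite nonempty set (the vertices) and $\mathcal{H}\subseteq 2^V$ contains all singletons and is closed under taking subsets. $P_{\leq n}(V)$ is the set of subsets of $V$ of size at most $n$. $S$ is boolean representable (BRSC) if there is a boolean matrix $M$ with columns indexed by $V$ such that $\mathcal{H}$ is exactly the set of $X\subseteq V$ for which some square submatrix with column set $X$ is congruent (by permuting rows and columns) to a lower unitriangular boolean matrix. For $k\geq1$, $T_k(S)=(V,\mathcal{H}\cap P_{\leq k}(V))$; $S$ is a TBRSC if $S=T_k(S')$ for some BRSC $S'$ and $k\geq1$. -}

module Defs where

open import Data.Nat using (ℕ; _≤_; _<_)
open import Data.Bool using (Bool; true; false)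
open import Data.Fin using (Fin; _<_)
open import Data.Fin.Subset using (Subset; _∈_; _⊆_; ⁅_⁆; ∣_∣)
open import Data.Product using (Σ; ∃; _×_)
open import Function.Bundles using (_⇔_)
open import Function.Definitions using (Injective)
open import Relation.Binary.PropositionalEquality using (_≡_)

record SimplicialComplex (n : ℕ) : Set₁ where
  field
    H          : Subset n → Set
    singletons : ∀ (v : Fin n) → H ⁅ v ⁆
    down-closed : ∀ {X Y : Subset n} → Y ⊆ X → H X → H Y
open SimplicialComplex public

BoolMatrix : ℕ → ℕ → Set
BoolMatrix m n = Fin m → Fin n → Bool

LowerUnitriangularSub : ∀ {m n k} → BoolMatrix m n → (Fin k → Fin m) → (Fin k → Fin n) → Set
LowerUnitriangularSub M r c =
  (∀ i → M (r i) (c i) ≡ true) × (∀ i j → i Data.Fin.< j → M (r i) (c j) ≡ false)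

-- X is independent for M: some square submatrix of M with column set X is
-- congruent (by permuting rows and columns) to a lower unitriangular matrix.
-- The permutations are absorbed into the choice of injective enumerations r of
-- distinct rows and c of the columns in X.
Independent : ∀ {m n} → BoolMatrix m n → Subset n → Set
Independent {m} {n} M X =
  Σ ℕ λ k → Σ (Fin k → Fin m) λ r → Σ (Fin k → Fin n) λ c →
    Injective _≡_ _≡_ r × Injective _≡_ _≡_ c ×
    (∀ x → (x ∈ X) ⇔ ∃ (λ i → c i ≡ x)) ×
    LowerUnitriangularSub M r c

IsBRSC : ∀ {n} → SimplicialComplex n → Set
IsBRSC {n} S = Σ ℕ λ m → Σ (BoolMatrix m n) λ M → ∀ X → H S X ⇔ Independent M X

IsTruncation : ∀ {n} → ℕ → SimplicialComplex n → SimplicialComplex n → Set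
IsTruncation k S S' = ∀ X → H S X ⇔ (H S' X × ∣ X ∣ ≤ k)

IsTBRSC : ∀ {n} → SimplicialComplex n → Set₁
IsTBRSC {n} S = Σ (SimplicialComplex n) λ S' → Σ ℕ λ k →
  IsBRSC S' × 1 ≤ k × IsTruncation k S S'

-- A simplicial complex with decidable faces is boolean representable exactly when every face X
-- can be peeled: some x ∈ X lies outside a flat Z ⊇ X - x (adding a vertex outside Z to a face
-- inside Z gives a face), and X - x can be peeled again. The rows of a lower unitriangular
-- submatrix give such a peeling, since the zero set of a row is a flat; conversely the
-- complements of all flats form a representing matrix.
--
-- Let S = T_k(S′) with S′ boolean representable, and let X be a face of S. Peeling X in S′ gives
-- a vertex a and an S′-flat Z. An S′-flat P with X - x ⊆ P and x ∉ P is also a flat of S as soon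
-- as every face inside P has fewer than k vertices, so it suffices to find such a P for some
-- x ∈ X. According as X - a has 0, 1, 2 or at least 3 vertices, take: ∅; the vertex y of X - a
-- with its non-neighbours; a pair {a, b} all of whose extensions by a vertex are faces, or the
-- vertices detached from X - a; and Z, or X - a when Z contains a face with k vertices (then
-- n ≤ 5 makes every set a face). Two non-adjacent vertices are interchangeable in the faces of a
-- boolean representable complex, and n ≤ 5 only enters through the fact that five distinct
-- vertices exhaust the vertex set.

module Submission where

open import Defs
open import Data.Nat using (ℕ; zero; suc; _+_; _≤_; _<_; _≤?_; z≤n; s≤s)
open import Data.Nat.Properties using (≤-refl; ≤-trans; ≤-antisym; <-≤-trans; ≤-<-trans; n≤1+n; ≰⇒>; ≤⇒≯)
open import Data.Bool using (Bool; true; false; if_then_else_)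
open import Data.Bool.Properties using (¬-not)
import Data.Bool as Bool
open import Data.Empty using (⊥-elim)
open import Data.Fin using (Fin; zero; suc; _≟_; splitAt; join)
open import Data.Fin.Properties using (any?; all?; suc-injective; splitAt-join)
open import Data.Nat.Induction using (<-wellFounded)
open import Data.Vec.Functional using (_∷_)
open import Data.Fin.Subset
open import Data.Fin.Subset.Properties
open import Data.Product using (∃; _×_; _,_; proj₁; proj₂)
open import Data.Sum using (_⊎_; inj₁; inj₂)
import Data.Sum
open import Data.Vec using (here; there; lookup; tabulate) renaming (_∷_ to _∷ᵛ_; [] to []ᵛ)
open import Data.Vec.Properties using ([]=⇒lookup; lookup⇒[]=; lookup∘tabulate)
open import Function.Base using (_∘_)
open import Function.Bundles using (_⇔_; mk⇔; Equivalence)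
open import Function.Definitions using (Injective)
open import Induction.WellFounded using (module All)
open import Relation.Nullary using (¬_; Dec; yes; no; does; ¬?)
open import Relation.Nullary.Decidable using (map′; _×-dec_; _→-dec_; _⊎-dec_; decidable-stable; dec-true; dec-false)
import Relation.Binary.Construct.On as On
open import Relation.Binary.PropositionalEquality using (_≡_; _≢_; refl; sym; trans; cong; subst)

private variable
  n : ℕ
  x y z : Fin n
  p q r : Subset n

x∈p─q⇒x∉q : ∀ (p q : Subset n) → x ∈ p ─ q → x ∉ q
x∈p─q⇒x∉q (s ∷ᵛ p) (outside ∷ᵛ q) here ()
x∈p─q⇒x∉q (s ∷ᵛ p) (inside ∷ᵛ q) () here
x∈p─q⇒x∉q (s ∷ᵛ p) (t ∷ᵛ q) (there x∈) (there x∈q) = x∈p─q⇒x∉q p q x∈ x∈q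

x∈p-y⇒x≢y : x ∈ p - y → x ≢ y
x∈p-y⇒x≢y {p = p} {y = y} x∈ refl = x∈p─q⇒x∉q p ⁅ y ⁆ x∈ (x∈⁅x⁆ y)

x∉p-x : x ∉ p - x
x∉p-x x∈ = x∈p-y⇒x≢y x∈ refl

x∈p-y⇒x∈p : x ∈ p - y → x ∈ p
x∈p-y⇒x∈p {p = p} {y = y} = p─q⊆p p ⁅ y ⁆

x∈p∪⁅x⁆ : x ∈ p ∪ ⁅ x ⁆
x∈p∪⁅x⁆ {x = x} = x∈p∪q⁺ (inj₂ (x∈⁅x⁆ x))

p⊆p∪⁅x⁆ : p ⊆ p ∪ ⁅ x ⁆
p⊆p∪⁅x⁆ {x = x} = p⊆p∪q ⁅ x ⁆

x∈p∪⁅y⁆⁻ : x ∈ p ∪ ⁅ y ⁆ → x ∈ p ⊎ x ≡ y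
x∈p∪⁅y⁆⁻ {p = p} {y = y} x∈ with x∈p∪q⁻ p ⁅ y ⁆ x∈
... | inj₁ x∈p = inj₁ x∈p
... | inj₂ x∈y = inj₂ (x∈⁅y⁆⇒x≡y y x∈y)

p∪⁅x⁆-x⊆p : (p ∪ ⁅ x ⁆) - x ⊆ p
p∪⁅x⁆-x⊆p y∈ with x∈p∪⁅y⁆⁻ (x∈p-y⇒x∈p y∈)
... | inj₁ y∈p = y∈p
... | inj₂ refl = ⊥-elim (x∉p-x y∈)

∪⁅⁆-⊆ : p ⊆ r → x ∈ r → p ∪ ⁅ x ⁆ ⊆ r
∪⁅⁆-⊆ p⊆r x∈r y∈ with x∈p∪⁅y⁆⁻ y∈
... | inj₁ y∈p = p⊆r y∈p
... | inj₂ refl = x∈r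

⁅⁆-⊆ : x ∈ p → ⁅ x ⁆ ⊆ p
⁅⁆-⊆ {x = x} x∈p y∈ rewrite x∈⁅y⁆⇒x≡y x y∈ = x∈p

∪⁅⁆-mono : p ⊆ q → p ∪ ⁅ x ⁆ ⊆ q ∪ ⁅ x ⁆
∪⁅⁆-mono p⊆q = ∪⁅⁆-⊆ (λ y∈ → p⊆p∪⁅x⁆ (p⊆q y∈)) x∈p∪⁅x⁆

p⊆p-x∪⁅x⁆ : p ⊆ (p - x) ∪ ⁅ x ⁆
p⊆p-x∪⁅x⁆ {x = x} {y} y∈ with y ≟ x
... | yes refl = x∈p∪⁅x⁆
... | no y≢x = p⊆p∪⁅x⁆ (x∈p∧x≢y⇒x∈p-y y∈ y≢x)

∉⇒lookup≡false : x ∉ p → lookup p x ≡ false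
∉⇒lookup≡false {x = x} {p} x∉ = ¬-not (x∉ ∘ lookup⇒[]= x p)

lookup≡false⇒∉ : lookup p x ≡ false → x ∉ p
lookup≡false⇒∉ e x∈ with trans (sym ([]=⇒lookup x∈)) e
... | ()

∈∁tabulate⇔ : ∀ {f : Fin n → Bool} → x ∈ ∁ (tabulate f) ⇔ f x ≡ false
∈∁tabulate⇔ {x = x} {f} = mk⇔
  (λ x∈ → trans (sym (lookup∘tabulate f x)) (∉⇒lookup≡false (x∈∁p⇒x∉p x∈)))
  (λ fx≡false → x∉p⇒x∈∁p (lookup≡false⇒∉ (trans (lookup∘tabulate f x) fx≡false)))

filterˢ : ∀ {P : Fin n → Set} → (∀ x → Dec (P x)) → Subset n
filterˢ P? = tabulate (does ∘ P?)

∈filterˢ⇔ : ∀ {P : Fin n → Set} (P? : ∀ x → Dec (P x)) → x ∈ filterˢ P? ⇔ P x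
∈filterˢ⇔ {x = x} P? = mk⇔
  (λ x∈ → decidable-stable (P? x) λ ¬Px → true≢false (trans (sym (does≡ x∈)) (dec-false (P? x) ¬Px)))
  (λ Px → lookup⇒[]= x _ (trans (lookup∘tabulate _ x) (dec-true (P? x) Px)))
  where
  does≡ : x ∈ filterˢ P? → does (P? x) ≡ true
  does≡ x∈ = trans (sym (lookup∘tabulate _ x)) ([]=⇒lookup x∈)
  true≢false : true ≢ false
  true≢false ()

allSubset? : ∀ {P : Subset n → Set} → (∀ p → Dec (P p)) → Dec (∀ p → P p)
allSubset? P? with anySubset? (¬? ∘ P?)
... | yes (p , ¬Pp) = no λ all → ¬Pp (all p)
... | no ∄¬P = yes λ p → decidable-stable (P? p) λ ¬Pp → ∄¬P (p , ¬Pp)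

∣p∪⁅x⁆∣≤1+∣p∣ : ∀ (p : Subset n) x → ∣ p ∪ ⁅ x ⁆ ∣ ≤ suc ∣ p ∣
∣p∪⁅x⁆∣≤1+∣p∣ (outside ∷ᵛ p) zero rewrite ∪-identityʳ p = ≤-refl
∣p∪⁅x⁆∣≤1+∣p∣ (inside ∷ᵛ p) zero rewrite ∪-identityʳ p = n≤1+n _
∣p∪⁅x⁆∣≤1+∣p∣ (outside ∷ᵛ p) (suc x) = ∣p∪⁅x⁆∣≤1+∣p∣ p x
∣p∪⁅x⁆∣≤1+∣p∣ (inside ∷ᵛ p) (suc x) = s≤s (∣p∪⁅x⁆∣≤1+∣p∣ p x)

x∉p⇒∣p∣<∣p∪⁅x⁆∣ : x ∉ p → ∣ p ∣ < ∣ p ∪ ⁅ x ⁆ ∣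
x∉p⇒∣p∣<∣p∪⁅x⁆∣ x∉p = p⊂q⇒∣p∣<∣q∣ (p⊆p∪⁅x⁆ , _ , x∈p∪⁅x⁆ , x∉p)

n≤∣p∣⇒x∈p : ∀ {n} {x : Fin n} {p : Subset n} → n ≤ ∣ p ∣ → x ∈ p
n≤∣p∣⇒x∈p {x = x} {p} n≤∣p∣ = subst (x ∈_) (sym (∣p∣≡n⇒p≡⊤ (≤-antisym (∣p∣≤n p) n≤∣p∣))) ∈⊤

3≤∣p∣ : x ∈ p → y ∈ p - x → z ∈ p - x - y → 3 ≤ ∣ p ∣
3≤∣p∣ x∈ y∈ z∈ = ≤-trans (s≤s (s≤s (≤-trans (s≤s z≤n) (x∈p⇒∣p-x∣<∣p∣ z∈))))
  (≤-trans (s≤s (x∈p⇒∣p-x∣<∣p∣ y∈)) (x∈p⇒∣p-x∣<∣p∣ x∈))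

sizeRec : (P : Subset n → Set) → (∀ X → (∀ {Y} → ∣ Y ∣ < ∣ X ∣ → P Y) → P X) → ∀ X → P X
sizeRec = All.wfRec (On.wellFounded ∣_∣ <-wellFounded) _

data Peeling (Sep : Fin n → Subset n → Set) : Subset n → Set where
  done : ∀ {X} → Empty X → Peeling Sep X
  peel : ∀ {X x} → x ∈ X → Sep x (X - x) → Peeling Sep (X - x) → Peeling Sep X

module _ {Sep : Fin n → Subset n → Set} where

  peeling-map : ∀ {Sep′} → (∀ {x Y} → Sep x Y → Sep′ x Y) → ∀ {X} → Peeling Sep X → Peeling Sep′ X
  peeling-map f (done empty) = done empty
  peeling-map f (peel x∈ sep π) = peel x∈ (f sep) (peeling-map f π)

  peeling? : (∀ x Y → Dec (Sep x Y)) → ∀ X → Dec (Peeling Sep X)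
  peeling? sep? = sizeRec _ λ X rec → decide X rec (nonempty? X)
    where
    decide : ∀ X → (∀ {Y} → ∣ Y ∣ < ∣ X ∣ → Dec (Peeling Sep Y)) → Dec (Nonempty X) → Dec (Peeling Sep X)
    decide X rec (no empty) = yes (done empty)
    decide X rec (yes (x₀ , x₀∈)) = map′ (λ (x , x∈ , sep , π) → peel x∈ sep π) head (any? first?)
      where
      first? : ∀ x → Dec (x ∈ X × Sep x (X - x) × Peeling Sep (X - x))
      first? x with x ∈? X
      ... | no x∉ = no (x∉ ∘ proj₁)
      ... | yes x∈ = map′ (x∈ ,_) proj₂ (sep? x (X - x) ×-dec rec (x∈p⇒∣p-x∣<∣p∣ x∈))
      head : Peeling Sep X → ∃ λ x → x ∈ X × Sep x (X - x) × Peeling Sep (X - x)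
      head (done empty) = ⊥-elim (empty (x₀ , x₀∈))
      head (peel x∈ sep π) = _ , x∈ , sep , π

  peeling-of-steps : (G : Subset n → Set) → (∀ {X Y} → Y ⊆ X → G X → G Y) →
    (∀ {X x₀} → G X → x₀ ∈ X → ∃ λ x → x ∈ X × Sep x (X - x)) → ∀ {X} → G X → Peeling Sep X
  peeling-of-steps G down step {X} = sizeRec (λ X → G X → Peeling Sep X) go X
    where
    go : ∀ X → (∀ {Y} → ∣ Y ∣ < ∣ X ∣ → G Y → Peeling Sep Y) → G X → Peeling Sep X
    go X rec GX with nonempty? X
    ... | no empty = done empty
    ... | yes (x₀ , x₀∈) with step GX x₀∈
    ... | x , x∈ , sep = peel x∈ sep (rec (x∈p⇒∣p-x∣<∣p∣ x∈) (down x∈p-y⇒x∈p GX))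

Enumerates : ∀ {k} → (Fin k → Fin n) → Subset n → Set
Enumerates c X = ∀ y → y ∈ X ⇔ ∃ λ i → c i ≡ y

enumerates-tail : ∀ {k} {c : Fin (suc k) → Fin n} {X} → Injective _≡_ _≡_ c →
  Enumerates c X → Enumerates (c ∘ suc) (X - c zero)
enumerates-tail {c = c} {X} c-inj enum y = mk⇔ to from
  where
  to : y ∈ X - c zero → ∃ λ j → c (suc j) ≡ y
  to y∈ with Equivalence.to (enum y) (x∈p-y⇒x∈p y∈)
  ... | zero , refl = ⊥-elim (x∉p-x y∈)
  ... | suc j , e = j , e
  from : (∃ λ j → c (suc j) ≡ y) → y ∈ X - c zero
  from (j , refl) = x∈p∧x≢y⇒x∈p-y (Equivalence.from (enum y) (suc j , refl)) λ e → case (c-inj e)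
    where
    case : suc j ≢ zero
    case ()

enumerates-cons : ∀ {k} {c : Fin k → Fin n} {X x} → x ∈ X →
  Enumerates c (X - x) → Enumerates (x ∷ c) X
enumerates-cons {c = c} {X} {x} x∈ enum y = mk⇔ to from
  where
  to : y ∈ X → ∃ λ i → (x ∷ c) i ≡ y
  to y∈ with y ≟ x
  ... | yes refl = zero , refl
  ... | no y≢x with Equivalence.to (enum y) (x∈p∧x≢y⇒x∈p-y y∈ y≢x)
  ... | j , e = suc j , e
  from : (∃ λ i → (x ∷ c) i ≡ y) → y ∈ X
  from (zero , refl) = x∈
  from (suc j , e) = x∈p-y⇒x∈p (Equivalence.from (enum y) (j , e))

∷-injective : ∀ {A : Set} {k} {a : A} {f : Fin k → A} →
  Injective _≡_ _≡_ f → (∀ i → f i ≢ a) → Injective _≡_ _≡_ (a ∷ f)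
∷-injective f-inj a∉f {zero} {zero} _ = refl
∷-injective f-inj a∉f {zero} {suc j} e = ⊥-elim (a∉f j (sym e))
∷-injective f-inj a∉f {suc i} {zero} e = ⊥-elim (a∉f i e)
∷-injective f-inj a∉f {suc i} {suc j} e = cong suc (f-inj e)

module _ {m n : ℕ} (M : BoolMatrix m n) where

  RowSeparates : Fin n → Subset n → Set
  RowSeparates x Y = ∃ λ r → M r x ≡ true × (∀ y → y ∈ Y → M r y ≡ false)

  rowSeparates? : ∀ x Y → Dec (RowSeparates x Y)
  rowSeparates? x Y = any? λ r → (M r x Bool.≟ true) ×-dec all? λ y → y ∈? Y →-dec (M r y Bool.≟ false)

  triangular⇒peeling : ∀ {k X} (r : Fin k → Fin m) (c : Fin k → Fin n) → Injective _≡_ _≡_ c →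
    Enumerates c X → LowerUnitriangularSub M r c → Peeling RowSeparates X
  triangular⇒peeling {zero} r c _ enum _ = done λ (y , y∈) → case (Equivalence.to (enum y) y∈)
    where
    case : ∀ {y} → ¬ ∃ λ (i : Fin 0) → c i ≡ y
    case (() , _)
  triangular⇒peeling {suc k} {X} r c c-inj enum (diag , upper) =
    peel (Equivalence.from (enum (c zero)) (zero , refl)) (r zero , diag zero , zeros)
      (triangular⇒peeling (r ∘ suc) (c ∘ suc) (suc-injective ∘ c-inj) (enumerates-tail c-inj enum)
        (diag ∘ suc , λ i j i<j → upper (suc i) (suc j) (s≤s i<j)))
    where
    zeros : ∀ y → y ∈ X - c zero → M (r zero) y ≡ false
    zeros y y∈ with Equivalence.to (enumerates-tail c-inj enum y) y∈
    ... | j , refl = upper zero (suc j) (s≤s z≤n)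

  independent⇒peeling : ∀ {X} → Independent M X → Peeling RowSeparates X
  independent⇒peeling (_ , r , c , _ , c-inj , enum , triangular) = triangular⇒peeling r c c-inj enum triangular

  peeling⇒independent : ∀ {X} → Peeling RowSeparates X → Independent M X
  peeling⇒independent (done empty) =
    0 , (λ ()) , (λ ()) , (λ { {()} }) , (λ { {()} }) ,
    (λ y → mk⇔ (λ y∈ → ⊥-elim (empty (y , y∈))) λ { (() , _) }) , (λ ()) , λ ()
  peeling⇒independent {X} (peel {x = x} x∈ (row , row-x , row-rest) π) with peeling⇒independent π
  ... | k , r , c , r-inj , c-inj , enum , diag , upper =
    suc k , row ∷ r , x ∷ c , ∷-injective r-inj row∉r , ∷-injective c-inj x∉c ,
    enumerates-cons x∈ enum , diag′ , upper′
    where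
    c∈ : ∀ j → c j ∈ X - x
    c∈ j = Equivalence.from (enum (c j)) (j , refl)
    x∉c : ∀ j → c j ≢ x
    x∉c j = x∈p-y⇒x≢y (c∈ j)
    row∉r : ∀ j → r j ≢ row
    row∉r j refl with trans (sym (diag j)) (row-rest (c j) (c∈ j))
    ... | ()
    diag′ : ∀ i → M ((row ∷ r) i) ((x ∷ c) i) ≡ true
    diag′ zero = row-x
    diag′ (suc i) = diag i
    upper′ : ∀ i j → i Data.Fin.< j → M ((row ∷ r) i) ((x ∷ c) j) ≡ false
    upper′ zero (suc j) _ = row-rest (c j) (c∈ j)
    upper′ (suc i) (suc j) (s≤s i<j) = upper i j i<j

module _ (F : Subset n → Set) where

  IsFlat : Subset n → Set
  IsFlat Z = ∀ {W p} → W ⊆ Z → F W → p ∉ Z → F (W ∪ ⁅ p ⁆)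

  FlatSeparates : Fin n → Subset n → Set
  FlatSeparates x Y = ∃ λ Z → IsFlat Z × x ∉ Z × Y ⊆ Z

  isFlat? : (∀ X → Dec (F X)) → ∀ Z → Dec (IsFlat Z)
  isFlat? F? Z = map′ (λ flat {W} {p} → flat W p) (λ flat W p → flat)
    (allSubset? λ W → all? λ p → W ⊆? Z →-dec F? W →-dec ¬? (p ∈? Z) →-dec F? (W ∪ ⁅ p ⁆))

flatPeeling⇒face : ∀ (S : SimplicialComplex n) → Fin n → ∀ {X} → Peeling (FlatSeparates (H S)) X → H S X
flatPeeling⇒face S v (done empty) = down-closed S (λ x∈ → ⊥-elim (empty (_ , x∈))) (singletons S v)
flatPeeling⇒face S v (peel x∈ (Z , flat , x∉Z , rest⊆Z) π) =
  down-closed S p⊆p-x∪⁅x⁆ (flat rest⊆Z (flatPeeling⇒face S v π) x∉Z)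

numSubsets : ℕ → ℕ
numSubsets zero = 1
numSubsets (suc n) = numSubsets n + numSubsets n

toSubset : Fin (numSubsets n) → Subset n
toSubset {zero} _ = []ᵛ
toSubset {suc n} i with splitAt (numSubsets n) i
... | inj₁ j = inside ∷ᵛ toSubset j
... | inj₂ j = outside ∷ᵛ toSubset j

fromSubset : Subset n → Fin (numSubsets n)
fromSubset []ᵛ = zero
fromSubset {suc n} (inside ∷ᵛ p) = join (numSubsets n) (numSubsets n) (inj₁ (fromSubset p))
fromSubset {suc n} (outside ∷ᵛ p) = join (numSubsets n) (numSubsets n) (inj₂ (fromSubset p))

toSubset-fromSubset : ∀ (p : Subset n) → toSubset (fromSubset p) ≡ p
toSubset-fromSubset []ᵛ = refl
toSubset-fromSubset {suc n} (inside ∷ᵛ p)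
  rewrite splitAt-join (numSubsets n) (numSubsets n) (inj₁ (fromSubset p)) = cong (inside ∷ᵛ_) (toSubset-fromSubset p)
toSubset-fromSubset {suc n} (outside ∷ᵛ p)
  rewrite splitAt-join (numSubsets n) (numSubsets n) (inj₂ (fromSubset p)) = cong (outside ∷ᵛ_) (toSubset-fromSubset p)

module _ {F : Subset n → Set} (F? : ∀ X → Dec (F X)) where

  flatRow : Fin (numSubsets n) → Subset n
  flatRow i = if does (isFlat? F F? (toSubset i)) then ∁ (toSubset i) else ⊥

  flatMatrix : BoolMatrix (numSubsets n) n
  flatMatrix i = lookup (flatRow i)

  flatRow-spec : ∀ i → (IsFlat F (toSubset i) × flatRow i ≡ ∁ (toSubset i)) ⊎ (¬ IsFlat F (toSubset i) × flatRow i ≡ ⊥)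
  flatRow-spec i = select (isFlat? F F? (toSubset i))
    where
    select : ∀ {Z} (d : Dec (IsFlat F Z)) →
      (IsFlat F Z × (if does d then ∁ Z else ⊥) ≡ ∁ Z) ⊎ (¬ IsFlat F Z × (if does d then ∁ Z else ⊥) ≡ ⊥)
    select (yes flat) = inj₁ (flat , refl)
    select (no ¬flat) = inj₂ (¬flat , refl)

  flatRow-fromSubset : ∀ {Z} → IsFlat F Z → flatRow (fromSubset Z) ≡ ∁ Z
  flatRow-fromSubset {Z} flat with flatRow-spec (fromSubset Z)
  ... | inj₁ (_ , row≡) = trans row≡ (cong ∁ (toSubset-fromSubset Z))
  ... | inj₂ (¬flat , _) = ⊥-elim (¬flat (subst (IsFlat F) (sym (toSubset-fromSubset Z)) flat))

  rowSeparates-flatMatrix⇔ : ∀ {x Y} → RowSeparates flatMatrix x Y ⇔ FlatSeparates F x Y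
  rowSeparates-flatMatrix⇔ = mk⇔ rowSeparates⇒flatSeparates flatSeparates⇒rowSeparates
    where
    rowSeparates⇒flatSeparates : ∀ {x Y} → RowSeparates flatMatrix x Y → FlatSeparates F x Y
    rowSeparates⇒flatSeparates {x} {Y} (i , row-x , row-Y) with flatRow-spec i
    ... | inj₁ (flat , row≡) rewrite row≡ =
      toSubset i , flat , x∈∁p⇒x∉p (lookup⇒[]= x _ row-x) , λ {y} y∈ → x∉∁p⇒x∈p (lookup≡false⇒∉ (row-Y y y∈))
    ... | inj₂ (_ , row≡) rewrite row≡ = ⊥-elim (∉⊥ (lookup⇒[]= x ⊥ row-x))
    flatSeparates⇒rowSeparates : ∀ {x Y} → FlatSeparates F x Y → RowSeparates flatMatrix x Y
    flatSeparates⇒rowSeparates {x} {Y} (Z , flat , x∉Z , Y⊆Z) =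
      fromSubset Z , subst (λ row → lookup row x ≡ true) (sym (flatRow-fromSubset flat)) ([]=⇒lookup (x∉p⇒x∈∁p x∉Z)) ,
      λ y y∈ → subst (λ row → lookup row y ≡ false) (sym (flatRow-fromSubset flat)) (∉⇒lookup≡false (x∈p⇒x∉∁p (Y⊆Z y∈)))

module _ (S : SimplicialComplex n) where

  flatPeelings⇒isBRSC : Fin n → (H? : ∀ X → Dec (H S X)) →
    (∀ {X} → H S X → Peeling (FlatSeparates (H S)) X) → IsBRSC S
  flatPeelings⇒isBRSC v H? flatPeeling = numSubsets n , flatMatrix H? , λ X → mk⇔
    (λ face → peeling⇒independent (flatMatrix H?)
      (peeling-map (Equivalence.from (rowSeparates-flatMatrix⇔ H?)) (flatPeeling face)))
    (λ independent → flatPeeling⇒face S v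
      (peeling-map (Equivalence.to (rowSeparates-flatMatrix⇔ H?)) (independent⇒peeling (flatMatrix H?) independent)))

  module _ {m} (M : BoolMatrix m n) (H⇔ : ∀ X → H S X ⇔ Independent M X) where

    represented-decidable : ∀ X → Dec (H S X)
    represented-decidable X =
      map′ (Equivalence.from (H⇔ X) ∘ peeling⇒independent M) (independent⇒peeling M ∘ Equivalence.to (H⇔ X))
        (peeling? (rowSeparates? M) X)

    rowSeparates⇒flatSeparates : ∀ {x Y} → RowSeparates M x Y → FlatSeparates (H S) x Y
    rowSeparates⇒flatSeparates {x} {Y} (r , row-x , row-Y) = zeros , flat , x∉zeros , Y⊆zeros
      where
      zeros : Subset n
      zeros = ∁ (tabulate (M r))
      x∉zeros : x ∉ zeros
      x∉zeros x∈ with trans (sym row-x) (Equivalence.to ∈∁tabulate⇔ x∈)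
      ... | ()
      Y⊆zeros : Y ⊆ zeros
      Y⊆zeros {y} y∈ = Equivalence.from ∈∁tabulate⇔ (row-Y y y∈)
      flat : IsFlat (H S) zeros
      flat {W} {p} W⊆ face p∉ = Equivalence.from (H⇔ _) (peeling⇒independent M
        (peel x∈p∪⁅x⁆ (r , ¬-not (p∉ ∘ Equivalence.from ∈∁tabulate⇔) ,
                        λ y y∈ → Equivalence.to ∈∁tabulate⇔ (W⊆ (p∪⁅x⁆-x⊆p y∈)))
          (independent⇒peeling M (Equivalence.to (H⇔ _) (down-closed S p∪⁅x⁆-x⊆p face)))))

    represented-flatPeeling : ∀ {X} → H S X → Peeling (FlatSeparates (H S)) X
    represented-flatPeeling {X} face =
      peeling-map rowSeparates⇒flatSeparates (independent⇒peeling M (Equivalence.to (H⇔ X) face))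

∣⁅x⁆∪⁅y⁆∣≤2 : ∀ (x y : Fin n) → ∣ ⁅ x ⁆ ∪ ⁅ y ⁆ ∣ ≤ 2
∣⁅x⁆∪⁅y⁆∣≤2 x y = subst (λ m → ∣ ⁅ x ⁆ ∪ ⁅ y ⁆ ∣ ≤ suc m) (∣⁅x⁆∣≡1 x) (∣p∪⁅x⁆∣≤1+∣p∣ ⁅ x ⁆ y)

subsingleton⇒∣p∣≤1 : ∀ {n} {p : Subset n} → (∀ {x y} → x ∈ p → y ∈ p → x ≡ y) → ∣ p ∣ ≤ 1
subsingleton⇒∣p∣≤1 {n} {p} unique with nonempty? p
... | no empty = subst (_≤ 1) (sym (trans (cong ∣_∣ (Empty-unique empty)) (∣⊥∣≡0 n))) z≤n
... | yes (x , x∈) = subst (∣ p ∣ ≤_) (∣⁅x⁆∣≡1 x) (p⊆q⇒∣p∣≤∣q∣ λ y∈ → subst (_∈ ⁅ x ⁆) (unique x∈ y∈) (x∈⁅x⁆ x))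

module _ (F : Subset n → Set) where

  SmallFlatSeparates : ℕ → Fin n → Subset n → Set
  SmallFlatSeparates k x Y = ∃ λ P → IsFlat F P × (∀ {W} → W ⊆ P → F W → ∣ W ∣ < k) × x ∉ P × Y ⊆ P

smallFlatSeparates⇒flatSeparates : ∀ {k} {S S′ : SimplicialComplex n} {Y} → IsTruncation k S S′ →
  SmallFlatSeparates (H S′) k x Y → FlatSeparates (H S) x Y
smallFlatSeparates⇒flatSeparates trunc (P , flat , small , x∉P , Y⊆P) = P , flat′ , x∉P , Y⊆P
  where
  flat′ : IsFlat _ P
  flat′ {W} {p} W⊆P face p∉P with Equivalence.to (trunc W) face
  ... | face′ , _ = Equivalence.from (trunc _) (flat W⊆P face′ p∉P , ≤-trans (∣p∪⁅x⁆∣≤1+∣p∣ W p) (small W⊆P face′))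

data Shape (Y : Subset n) : Set where
  none : Empty Y → Shape Y
  one : y ∈ Y → (∀ {z} → z ∈ Y → z ≡ y) → Shape Y
  two : y ∈ Y → z ∈ Y → y ≢ z → (∀ {x} → x ∈ Y → x ≡ y ⊎ x ≡ z) → Shape Y
  many : 3 ≤ ∣ Y ∣ → Shape Y

shape : ∀ (Y : Subset n) → Shape Y
shape Y with nonempty? Y
... | no ∅ = none ∅
... | yes (b , b∈) with nonempty? (Y - b)
...   | no only-b = one b∈ λ {z} z∈ → decidable-stable (z ≟ b) λ z≢b → only-b (z , x∈p∧x≢y⇒x∈p-y z∈ z≢b)
...   | yes (c , c∈) with nonempty? (Y - b - c)
...     | yes (_ , d∈) = many (3≤∣p∣ b∈ c∈ d∈)
...     | no only-bc = two b∈ (x∈p-y⇒x∈p c∈) (λ b≡c → x∈p-y⇒x≢y c∈ (sym b≡c)) cover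
  where
  cover : ∀ {x} → x ∈ Y → x ≡ b ⊎ x ≡ c
  cover {x} x∈ with x ≟ b | x ≟ c
  ... | yes x≡b | _ = inj₁ x≡b
  ... | no _ | yes x≡c = inj₂ x≡c
  ... | no x≢b | no x≢c = ⊥-elim (only-bc (x , x∈p∧x≢y⇒x∈p-y (x∈p∧x≢y⇒x∈p-y x∈ x≢b) x≢c))

module BooleanRepresentable {n} (S : SimplicialComplex n) (H? : ∀ X → Dec (H S X))
  (flatPeeling : ∀ {X} → H S X → Peeling (FlatSeparates (H S)) X) where

  private
    Face : Subset n → Set
    Face = H S
    down : ∀ {X Y} → Y ⊆ X → Face X → Face Y
    down = down-closed S

  pair-sym : Face (⁅ x ⁆ ∪ ⁅ y ⁆) → Face (⁅ y ⁆ ∪ ⁅ x ⁆)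
  pair-sym = down (∪⁅⁆-⊆ (⁅⁆-⊆ x∈p∪⁅x⁆) (p⊆p∪⁅x⁆ (x∈⁅x⁆ _)))

  nonEdge-swap : ∀ {w p} → ¬ Face (⁅ w ⁆ ∪ ⁅ p ⁆) → ∀ U → w ∉ U → p ∉ U → Face (U ∪ ⁅ p ⁆) → Face (U ∪ ⁅ w ⁆)
  nonEdge-swap {w} {p} ¬wp = sizeRec _ λ U rec w∉U p∉U face → swap U rec w∉U p∉U face (flatPeeling face)
    where
    swap : ∀ U → (∀ {V} → ∣ V ∣ < ∣ U ∣ → w ∉ V → p ∉ V → Face (V ∪ ⁅ p ⁆) → Face (V ∪ ⁅ w ⁆)) →
      w ∉ U → p ∉ U → Face (U ∪ ⁅ p ⁆) → Peeling (FlatSeparates Face) (U ∪ ⁅ p ⁆) → Face (U ∪ ⁅ w ⁆)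
    swap U rec w∉U p∉U face (done empty) = ⊥-elim (empty (p , x∈p∪⁅x⁆))
    swap U rec w∉U p∉U face (peel {x = x} x∈ (Z , flat , x∉Z , rest⊆Z) _) with x ≟ p | w ∈? Z
    ... | yes refl | yes w∈Z = ⊥-elim (¬wp (flat (⁅⁆-⊆ w∈Z) (singletons S w) x∉Z))
    ... | yes refl | no w∉Z = flat U⊆Z (down p⊆p∪⁅x⁆ face) w∉Z
      where
      U⊆Z : U ⊆ Z
      U⊆Z y∈ = rest⊆Z (x∈p∧x≢y⇒x∈p-y (p⊆p∪⁅x⁆ y∈) λ { refl → p∉U y∈ })
    ... | no x≢p | no w∉Z =
      ⊥-elim (¬wp (pair-sym (flat (⁅⁆-⊆ (rest⊆Z (x∈p∧x≢y⇒x∈p-y x∈p∪⁅x⁆ λ e → x≢p (sym e)))) (singletons S p) w∉Z)))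
    ... | no x≢p | yes w∈Z = down U∪w⊆ (flat (∪⁅⁆-⊆ (λ y∈ → rest⊆Z (U-x⊆ y∈)) w∈Z) swapped x∉Z)
      where
      x∈U : x ∈ U
      x∈U with x∈p∪⁅y⁆⁻ x∈
      ... | inj₁ x∈U = x∈U
      ... | inj₂ x≡p = ⊥-elim (x≢p x≡p)
      U-x⊆ : U - x ⊆ (U ∪ ⁅ p ⁆) - x
      U-x⊆ y∈ = x∈p∧x≢y⇒x∈p-y (p⊆p∪⁅x⁆ (x∈p-y⇒x∈p y∈)) (x∈p-y⇒x≢y y∈)
      swapped : Face ((U - x) ∪ ⁅ w ⁆)
      swapped = rec (x∈p⇒∣p-x∣<∣p∣ x∈U) (w∉U ∘ x∈p-y⇒x∈p) (p∉U ∘ x∈p-y⇒x∈p)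
        (down (∪⁅⁆-mono x∈p-y⇒x∈p) face)
      U∪w⊆ : U ∪ ⁅ w ⁆ ⊆ ((U - x) ∪ ⁅ w ⁆) ∪ ⁅ x ⁆
      U∪w⊆ = ∪⁅⁆-⊆ (⊆-trans p⊆p-x∪⁅x⁆ (∪⁅⁆-mono p⊆p∪⁅x⁆)) (p⊆p∪⁅x⁆ x∈p∪⁅x⁆)

  allFaces-isFlat : ∀ {P} → (∀ q → Face (P ∪ ⁅ q ⁆)) → IsFlat Face P
  allFaces-isFlat faces {p = q} W⊆P _ _ = down (∪⁅⁆-mono W⊆P) (faces q)

  module Truncation (n≤5 : n ≤ 5) (k : ℕ) (1≤k : 1 ≤ k) where

    Separable : Subset n → Set
    Separable X = ∃ λ x → x ∈ X × SmallFlatSeparates Face k x (X - x)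

    small-if-∣P∣<k : ∀ {P} → ∣ P ∣ < k → ∀ {W} → W ⊆ P → Face W → ∣ W ∣ < k
    small-if-∣P∣<k ∣P∣<k W⊆P _ = ≤-<-trans (p⊆q⇒∣p∣≤∣q∣ W⊆P) ∣P∣<k

    5≤∣p∣⇒x∈p : ∀ {x p} → 5 ≤ ∣ p ∣ → x ∈ p
    5≤∣p∣⇒x∈p 5≤∣p∣ = n≤∣p∣⇒x∈p (≤-trans n≤5 5≤∣p∣)

    module Step {X Z a} (faceX : Face X) (∣X∣≤k : ∣ X ∣ ≤ k) (a∈X : a ∈ X)
      (flatZ : IsFlat Face Z) (a∉Z : a ∉ Z) (Y⊆Z : X - a ⊆ Z) where

      Y : Subset n
      Y = X - a

      ∣Y∣<k : ∣ Y ∣ < k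
      ∣Y∣<k = <-≤-trans (x∈p⇒∣p-x∣<∣p∣ a∈X) ∣X∣≤k

      X⊆Y∪a : ∀ {z} → z ∈ X → z ≡ a ⊎ z ∈ Y
      X⊆Y∪a {z} z∈ with z ≟ a
      ... | yes z≡a = inj₁ z≡a
      ... | no z≢a = inj₂ (x∈p∧x≢y⇒x∈p-y z∈ z≢a)

      none-separable : Empty Y → Separable X
      none-separable ∅ = a , a∈X , ⊥ , ⊥-flat , small , ∉⊥ , λ y∈ → ⊥-elim (∅ (_ , y∈))
        where
        ⊥-flat : IsFlat Face ⊥
        ⊥-flat {p = p} W⊆⊥ _ _ = down (∪⁅⁆-⊆ (⊆-trans W⊆⊥ ⊥⊆) (x∈⁅x⁆ p)) (singletons S p)
        small : ∀ {W} → W ⊆ ⊥ → Face W → ∣ W ∣ < k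
        small = small-if-∣P∣<k (subst (_< k) (sym (∣⊥∣≡0 n)) 1≤k)

      module One {y} (y∈Y : y ∈ Y) (Y⊆y : ∀ {z} → z ∈ Y → z ≡ y) where

        NonNeighbour : Fin n → Set
        NonNeighbour z = z ≡ y ⊎ ¬ Face (⁅ y ⁆ ∪ ⁅ z ⁆)

        nonNeighbour? : ∀ z → Dec (NonNeighbour z)
        nonNeighbour? z = (z ≟ y) ⊎-dec ¬? (H? (⁅ y ⁆ ∪ ⁅ z ⁆))

        P : Subset n
        P = filterˢ nonNeighbour?

        ∈P⇔ : ∀ {z} → z ∈ P ⇔ NonNeighbour z
        ∈P⇔ = ∈filterˢ⇔ nonNeighbour?

        face-yy : Face (⁅ y ⁆ ∪ ⁅ y ⁆)
        face-yy = down (∪⁅⁆-⊆ ⊆-refl (x∈⁅x⁆ y)) (singletons S y)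

        a∉P : a ∉ P
        a∉P a∈P with Equivalence.to ∈P⇔ a∈P
        ... | inj₁ refl = x∉p-x y∈Y
        ... | inj₂ ¬ya = ¬ya (down (∪⁅⁆-⊆ (⁅⁆-⊆ (x∈p-y⇒x∈p y∈Y)) a∈X) faceX)

        independent : ∀ {z z′} → z ∈ P → z′ ∈ P → Face (⁅ z ⁆ ∪ ⁅ z′ ⁆) → z ≡ z′
        independent {z} {z′} z∈ z′∈ face
          with z ≟ z′ | Equivalence.to ∈P⇔ z∈ | Equivalence.to ∈P⇔ z′∈
        ... | yes z≡z′ | _ | _ = z≡z′
        ... | no z≢z′ | inj₁ refl | inj₁ refl = ⊥-elim (z≢z′ refl)
        ... | no _ | inj₁ refl | inj₂ ¬yz′ = ⊥-elim (¬yz′ face)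
        ... | no _ | inj₂ ¬yz | inj₁ refl = ⊥-elim (¬yz (pair-sym face))
        ... | no z≢z′ | inj₂ ¬yz | inj₂ ¬yz′ =
          ⊥-elim (¬yz′ (pair-sym (nonEdge-swap ¬yz ⁅ z′ ⁆ y∉z′ (z≢z′ ∘ x∈⁅y⁆⇒x≡y z′) (pair-sym face))))
          where
          y∉z′ : y ∉ ⁅ z′ ⁆
          y∉z′ y∈ = ¬yz′ (subst (λ t → Face (⁅ y ⁆ ∪ ⁅ t ⁆)) (x∈⁅y⁆⇒x≡y z′ y∈) face-yy)

        smallP : ∀ {W} → W ⊆ P → Face W → ∣ W ∣ < k
        smallP W⊆P faceW = <-≤-trans (s≤s (subsingleton⇒∣p∣≤1 λ z∈ z′∈ →
          independent (W⊆P z∈) (W⊆P z′∈) (down (∪⁅⁆-⊆ (⁅⁆-⊆ z∈) z′∈) faceW))) 2≤k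
          where
          2≤k : 2 ≤ k
          2≤k = ≤-<-trans (≤-trans (s≤s z≤n) (x∈p⇒∣p-x∣<∣p∣ y∈Y)) ∣Y∣<k

        flatP : IsFlat Face P
        flatP {W} {p} W⊆P faceW p∉P with nonempty? W
        ... | no ∅ = down (∪⁅⁆-⊆ (λ t∈ → ⊥-elim (∅ (_ , t∈))) (x∈⁅x⁆ p)) (singletons S p)
        ... | yes (z , z∈W) = down (∪⁅⁆-mono W⊆z) (edge (Equivalence.to ∈P⇔ (W⊆P z∈W)))
          where
          face-yp : Face (⁅ y ⁆ ∪ ⁅ p ⁆)
          face-yp = decidable-stable (H? _) λ ¬yp → p∉P (Equivalence.from ∈P⇔ (inj₂ ¬yp))
          W⊆z : W ⊆ ⁅ z ⁆
          W⊆z {t} t∈ = subst (_∈ ⁅ z ⁆)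
            (independent (W⊆P z∈W) (W⊆P t∈) (down (∪⁅⁆-⊆ (⁅⁆-⊆ z∈W) t∈) faceW)) (x∈⁅x⁆ z)
          edge : NonNeighbour z → Face (⁅ z ⁆ ∪ ⁅ p ⁆)
          edge (inj₁ refl) = face-yp
          edge (inj₂ ¬yz) = pair-sym (nonEdge-swap (¬yz ∘ pair-sym) ⁅ p ⁆ z∉p y∉p (pair-sym face-yp))
            where
            z∉p : z ∉ ⁅ p ⁆
            z∉p z∈ = p∉P (subst (_∈ P) (x∈⁅y⁆⇒x≡y p z∈) (W⊆P z∈W))
            y∉p : y ∉ ⁅ p ⁆
            y∉p y∈ = p∉P (Equivalence.from ∈P⇔ (inj₁ (sym (x∈⁅y⁆⇒x≡y p y∈))))

        one-separable : Separable X
        one-separable = a , a∈X , P , flatP , smallP , a∉P , λ z∈ → Equivalence.from ∈P⇔ (inj₁ (Y⊆y z∈))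

      many-separable : 3 ≤ ∣ Y ∣ → Separable X
      many-separable 3≤∣Y∣ with anySubset? (λ W → W ⊆? Z ×-dec H? W ×-dec k ≤? ∣ W ∣)
      ... | no ∄ = a , a∈X , Z , flatZ , (λ W⊆Z faceW → ≰⇒> λ k≤ → ∄ (_ , W⊆Z , faceW , k≤)) , a∉Z , Y⊆Z
      ... | yes (W , W⊆Z , faceW , k≤∣W∣) =
        a , a∈X , Y , allFaces-isFlat (λ _ → every-face) , small-if-∣P∣<k ∣Y∣<k , x∉p-x , (λ y∈ → y∈)
        where
        everything : ∀ {t} → t ∈ W ∪ ⁅ a ⁆
        everything = 5≤∣p∣⇒x∈p (≤-trans (s≤s (<-≤-trans (≤-<-trans 3≤∣Y∣ ∣Y∣<k) k≤∣W∣))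
          (x∉p⇒∣p∣<∣p∪⁅x⁆∣ (a∉Z ∘ W⊆Z)))
        every-face : ∀ {U} → Face U
        every-face = down (λ _ → everything) (flatZ W⊆Z faceW a∉Z)

      module Pair {b c} (b∈Y : b ∈ Y) (c∈Y : c ∈ Y) (b≢c : b ≢ c) (Y⊆bc : ∀ {z} → z ∈ Y → z ≡ b ⊎ z ≡ c) where

        3≤∣X∣ : 3 ≤ ∣ X ∣
        3≤∣X∣ = 3≤∣p∣ a∈X b∈Y (x∈p∧x≢y⇒x∈p-y c∈Y λ c≡b → b≢c (sym c≡b))

        ∈Y⇒∈X : ∀ {z} → z ∈ Y → z ∈ X
        ∈Y⇒∈X = x∈p-y⇒x∈p

        ∈Y⇒≢a : ∀ {z} → z ∈ Y → z ≢ a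
        ∈Y⇒≢a = x∈p-y⇒x≢y

        ∣Y∣≤2 : ∣ Y ∣ ≤ 2
        ∣Y∣≤2 = ≤-trans (p⊆q⇒∣p∣≤∣q∣ Y⊆bc′) (∣⁅x⁆∪⁅y⁆∣≤2 b c)
          where
          Y⊆bc′ : Y ⊆ ⁅ b ⁆ ∪ ⁅ c ⁆
          Y⊆bc′ z∈ with Y⊆bc z∈
          ... | inj₁ refl = p⊆p∪⁅x⁆ (x∈⁅x⁆ _)
          ... | inj₂ refl = x∈p∪⁅x⁆

        Extendable : Fin n → Set
        Extendable y = ∀ q → Face ((⁅ a ⁆ ∪ ⁅ y ⁆) ∪ ⁅ q ⁆)

        extendable? : ∀ y → Dec (Extendable y)
        extendable? y = all? λ q → H? ((⁅ a ⁆ ∪ ⁅ y ⁆) ∪ ⁅ q ⁆)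

        extendable-if-covered : ∀ {y} → y ∈ X → (∀ q → q ∈ X ⊎ Face ((⁅ a ⁆ ∪ ⁅ y ⁆) ∪ ⁅ q ⁆)) → Extendable y
        extendable-if-covered y∈X covered q with covered q
        ... | inj₁ q∈X = down (∪⁅⁆-⊆ (∪⁅⁆-⊆ (⁅⁆-⊆ a∈X) y∈X) q∈X) faceX
        ... | inj₂ face = face

        face-through : ∀ {U y t} → y ∈ U → t ∈ U → Face (U ∪ ⁅ a ⁆) → Face ((⁅ a ⁆ ∪ ⁅ y ⁆) ∪ ⁅ t ⁆)
        face-through y∈U t∈U = down (∪⁅⁆-⊆ (∪⁅⁆-⊆ (⁅⁆-⊆ x∈p∪⁅x⁆) (p⊆p∪⁅x⁆ y∈U)) (p⊆p∪⁅x⁆ t∈U))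

        extendable⇒separable : ∀ {y y′} → y ∈ Y → y′ ∈ Y → y ≢ y′ → (∀ {z} → z ∈ Y → z ≡ y ⊎ z ≡ y′) →
          Extendable y → Separable X
        extendable⇒separable {y} {y′} y∈Y y′∈Y y≢y′ Y⊆yy′ extendable =
          y′ , ∈Y⇒∈X y′∈Y , ⁅ a ⁆ ∪ ⁅ y ⁆ , allFaces-isFlat extendable ,
          small-if-∣P∣<k (≤-<-trans (∣⁅x⁆∪⁅y⁆∣≤2 a y) (≤-trans 3≤∣X∣ ∣X∣≤k)) , y′∉ay , rest⊆ay
          where
          y′∉ay : y′ ∉ ⁅ a ⁆ ∪ ⁅ y ⁆
          y′∉ay y′∈ with x∈p∪⁅y⁆⁻ y′∈
          ... | inj₁ y′∈a = ∈Y⇒≢a y′∈Y (x∈⁅y⁆⇒x≡y a y′∈a)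
          ... | inj₂ y′≡y = y≢y′ (sym y′≡y)
          rest⊆ay : X - y′ ⊆ ⁅ a ⁆ ∪ ⁅ y ⁆
          rest⊆ay z∈ with X⊆Y∪a (x∈p-y⇒x∈p z∈)
          ... | inj₁ refl = p⊆p∪⁅x⁆ (x∈⁅x⁆ a)
          ... | inj₂ z∈Y with Y⊆yy′ z∈Y
          ... | inj₁ refl = x∈p∪⁅x⁆
          ... | inj₂ refl = ⊥-elim (x∉p-x z∈)

        Detached : Fin n → Set
        Detached z = z ∈ Y ⊎ ¬ Face (Y ∪ ⁅ z ⁆)

        detached? : ∀ z → Dec (Detached z)
        detached? z = z ∈? Y ⊎-dec ¬? (H? (Y ∪ ⁅ z ⁆))

        D : Subset n
        D = filterˢ detached?

        ∈D⇔ : ∀ {z} → z ∈ D ⇔ Detached z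
        ∈D⇔ = ∈filterˢ⇔ detached?

        Y⊆D : Y ⊆ D
        Y⊆D z∈ = Equivalence.from ∈D⇔ (inj₁ z∈)

        ∈D∖Y⇒nonFace : ∀ {z} → z ∈ D → z ∉ Y → ¬ Face (Y ∪ ⁅ z ⁆)
        ∈D∖Y⇒nonFace z∈D z∉Y with Equivalence.to ∈D⇔ z∈D
        ... | inj₁ z∈Y = ⊥-elim (z∉Y z∈Y)
        ... | inj₂ ¬face = ¬face

        a∉D : a ∉ D
        a∉D a∈D = ∈D∖Y⇒nonFace a∈D x∉p-x (down (∪⁅⁆-⊆ x∈p-y⇒x∈p a∈X) faceX)

        D⊆Z : D ⊆ Z
        D⊆Z {z} z∈D with z ∈? Z | Equivalence.to ∈D⇔ z∈D
        ... | yes z∈Z | _ = z∈Z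
        ... | no _ | inj₁ z∈Y = Y⊆Z z∈Y
        ... | no z∉Z | inj₂ ¬face = ⊥-elim (¬face (flatZ Y⊆Z (down x∈p-y⇒x∈p faceX) z∉Z))

        module _ {W} (W⊆D : W ⊆ D) (faceW : Face W) where

          faceWa : Face (W ∪ ⁅ a ⁆)
          faceWa = flatZ (⊆-trans W⊆D D⊆Z) faceW a∉Z

          outside-Y? : Dec (∃ λ w → w ∈ W × w ∉ Y)
          outside-Y? = any? λ w → w ∈? W ×-dec ¬? (w ∈? Y)

          ∄outside-Y⇒W⊆Y : ¬ (∃ λ w → w ∈ W × w ∉ Y) → W ⊆ Y
          ∄outside-Y⇒W⊆Y ∄ {t} t∈W = decidable-stable (t ∈? Y) λ t∉Y → ∄ (t , t∈W , t∉Y)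

          missing⇒extendable : ∀ {y y′} → y ∈ Y → y′ ∈ Y → y ≢ y′ → y ∉ W → 3 ≤ ∣ W ∣ → Extendable y′
          missing⇒extendable {y} {y′} y∈Y y′∈Y y≢y′ y∉W 3≤∣W∣ = extendable-if-covered (∈Y⇒∈X y′∈Y) covered
            where
            everything : ∀ {t} → t ∈ (W ∪ ⁅ a ⁆) ∪ ⁅ y ⁆
            everything = 5≤∣p∣⇒x∈p (≤-trans (s≤s (≤-trans (s≤s 3≤∣W∣) (x∉p⇒∣p∣<∣p∪⁅x⁆∣ (a∉D ∘ W⊆D))))
              (x∉p⇒∣p∣<∣p∪⁅x⁆∣ y∉Wa))
              where
              y∉Wa : y ∉ W ∪ ⁅ a ⁆
              y∉Wa y∈ with x∈p∪⁅y⁆⁻ y∈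
              ... | inj₁ y∈W = y∉W y∈W
              ... | inj₂ y≡a = ∈Y⇒≢a y∈Y y≡a
            ∈W∪ay : ∀ {t} → t ∈ W ⊎ t ≡ a ⊎ t ≡ y
            ∈W∪ay with x∈p∪⁅y⁆⁻ everything
            ... | inj₂ t≡y = inj₂ (inj₂ t≡y)
            ... | inj₁ t∈Wa with x∈p∪⁅y⁆⁻ t∈Wa
            ... | inj₁ t∈W = inj₁ t∈W
            ... | inj₂ t≡a = inj₂ (inj₁ t≡a)
            y′∈W : y′ ∈ W
            y′∈W with ∈W∪ay {y′}
            ... | inj₁ y′∈W = y′∈W
            ... | inj₂ (inj₁ y′≡a) = ⊥-elim (∈Y⇒≢a y′∈Y y′≡a)
            ... | inj₂ (inj₂ y′≡y) = ⊥-elim (y≢y′ (sym y′≡y))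
            covered : ∀ q → q ∈ X ⊎ Face ((⁅ a ⁆ ∪ ⁅ y′ ⁆) ∪ ⁅ q ⁆)
            covered q with ∈W∪ay {q}
            ... | inj₁ q∈W = inj₂ (face-through y′∈W q∈W faceWa)
            ... | inj₂ (inj₁ refl) = inj₁ a∈X
            ... | inj₂ (inj₂ refl) = inj₁ (∈Y⇒∈X y∈Y)

          ∣W∣<3 : ¬ Extendable b → ¬ Extendable c → ∣ W ∣ < 3
          ∣W∣<3 ¬ext-b ¬ext-c = ≰⇒> large⇒⊥
            where
            large⇒⊥ : ¬ 3 ≤ ∣ W ∣
            large⇒⊥ 3≤∣W∣ with b ∈? W | c ∈? W
            ... | no b∉W | _ = ¬ext-c (missing⇒extendable b∈Y c∈Y b≢c b∉W 3≤∣W∣)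
            ... | _ | no c∉W = ¬ext-b (missing⇒extendable c∈Y b∈Y (b≢c ∘ sym) c∉W 3≤∣W∣)
            ... | yes b∈W | yes c∈W with outside-Y?
            ... | no ∄ = ≤⇒≯ (≤-trans (p⊆q⇒∣p∣≤∣q∣ (∄outside-Y⇒W⊆Y ∄)) ∣Y∣≤2) 3≤∣W∣
            ... | yes (w , w∈W , w∉Y) = ∈D∖Y⇒nonFace (W⊆D w∈W) w∉Y (down (∪⁅⁆-⊆ Y⊆W w∈W) faceW)
              where
              Y⊆W : Y ⊆ W
              Y⊆W z∈ with Y⊆bc z∈
              ... | inj₁ refl = b∈W
              ... | inj₂ refl = c∈W

          module _ {q} (q∉D : q ∉ D) where

            q∉Y : q ∉ Y
            q∉Y = q∉D ∘ Y⊆D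

            faceYq : Face (Y ∪ ⁅ q ⁆)
            faceYq = decidable-stable (H? _) λ ¬face → q∉D (Equivalence.from ∈D⇔ (inj₂ ¬face))

            module _ (q∈Z : q ∈ Z) {w} (w∈W : w ∈ W) (w∉Y : w ∉ Y) where

              faceYqa : Face ((Y ∪ ⁅ q ⁆) ∪ ⁅ a ⁆)
              faceYqa = flatZ (∪⁅⁆-⊆ Y⊆Z q∈Z) faceYq a∉Z

              w∉X : w ∉ X
              w∉X w∈X with X⊆Y∪a w∈X
              ... | inj₁ refl = a∉D (W⊆D w∈W)
              ... | inj₂ w∈Y = w∉Y w∈Y

              q∉X∪w : q ∉ X ∪ ⁅ w ⁆
              q∉X∪w q∈ with x∈p∪⁅y⁆⁻ q∈
              ... | inj₂ refl = q∉D (W⊆D w∈W)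
              ... | inj₁ q∈X with X⊆Y∪a q∈X
              ... | inj₁ refl = a∉Z q∈Z
              ... | inj₂ q∈Y = q∉Y q∈Y

              everything : ∀ {t} → t ∈ (X ∪ ⁅ w ⁆) ∪ ⁅ q ⁆
              everything = 5≤∣p∣⇒x∈p (≤-trans (s≤s (≤-trans (s≤s 3≤∣X∣) (x∉p⇒∣p∣<∣p∪⁅x⁆∣ w∉X)))
                (x∉p⇒∣p∣<∣p∪⁅x⁆∣ q∉X∪w))

              covers : ∀ t → t ∈ X ⊎ t ≡ w ⊎ t ≡ q
              covers t with x∈p∪⁅y⁆⁻ (everything {t})
              ... | inj₂ t≡q = inj₂ (inj₂ t≡q)
              ... | inj₁ t∈Xw = Data.Sum.map₂ inj₁ (x∈p∪⁅y⁆⁻ t∈Xw)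

              extendable-if-in-W : ∀ {y} → y ∈ Y → y ∈ W → Extendable y
              extendable-if-in-W y∈Y y∈W = extendable-if-covered (∈Y⇒∈X y∈Y) λ t → case t (covers t)
                where
                case : ∀ t → t ∈ X ⊎ t ≡ w ⊎ t ≡ q → t ∈ X ⊎ Face ((⁅ a ⁆ ∪ ⁅ _ ⁆) ∪ ⁅ t ⁆)
                case t (inj₁ t∈X) = inj₁ t∈X
                case t (inj₂ (inj₁ refl)) = inj₂ (face-through y∈W w∈W faceWa)
                case t (inj₂ (inj₂ refl)) = inj₂ (face-through (p⊆p∪⁅x⁆ y∈Y) x∈p∪⁅x⁆ faceYqa)

              W⊆w : b ∉ W → c ∉ W → W ⊆ ⁅ w ⁆
              W⊆w b∉W c∉W {t} t∈W with covers t
              ... | inj₂ (inj₁ refl) = x∈⁅x⁆ t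
              ... | inj₂ (inj₂ refl) = ⊥-elim (q∉D (W⊆D t∈W))
              ... | inj₁ t∈X with X⊆Y∪a t∈X
              ... | inj₁ refl = ⊥-elim (a∉D (W⊆D t∈W))
              ... | inj₂ t∈Y with Y⊆bc t∈Y
              ... | inj₁ refl = ⊥-elim (b∉W t∈W)
              ... | inj₂ refl = ⊥-elim (c∉W t∈W)

              extend-across : ¬ Extendable b → ¬ Extendable c → Face (W ∪ ⁅ q ⁆)
              extend-across ¬ext-b ¬ext-c with b ∈? W | c ∈? W
              ... | yes b∈W | _ = ⊥-elim (¬ext-b (extendable-if-in-W b∈Y b∈W))
              ... | _ | yes c∈W = ⊥-elim (¬ext-c (extendable-if-in-W c∈Y c∈W))
              ... | no b∉W | no c∉W with H? (⁅ w ⁆ ∪ ⁅ q ⁆)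
              ... | yes face-wq = down (∪⁅⁆-mono (W⊆w b∉W c∉W)) face-wq
              ... | no ¬wq = ⊥-elim (∈D∖Y⇒nonFace (W⊆D w∈W) w∉Y (nonEdge-swap ¬wq Y w∉Y q∉Y faceYq))

            extend : ¬ Extendable b → ¬ Extendable c → Face (W ∪ ⁅ q ⁆)
            extend ¬ext-b ¬ext-c with q ∈? Z
            ... | no q∉Z = flatZ (⊆-trans W⊆D D⊆Z) faceW q∉Z
            ... | yes q∈Z with outside-Y?
            ... | no ∄ = down (∪⁅⁆-mono (∄outside-Y⇒W⊆Y ∄)) faceYq
            ... | yes (w , w∈W , w∉Y) = extend-across q∈Z w∈W w∉Y ¬ext-b ¬ext-c

        pair-separable : Separable X
        pair-separable with extendable? b | extendable? c
        ... | yes ext-b | _ = extendable⇒separable b∈Y c∈Y b≢c Y⊆bc ext-b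
        ... | no _ | yes ext-c = extendable⇒separable c∈Y b∈Y (b≢c ∘ sym) (Data.Sum.swap ∘ Y⊆bc) ext-c
        ... | no ¬ext-b | no ¬ext-c =
          a , a∈X , D , (λ W⊆D faceW q∉D → extend W⊆D faceW q∉D ¬ext-b ¬ext-c) ,
          (λ W⊆D faceW → <-≤-trans (∣W∣<3 W⊆D faceW ¬ext-b ¬ext-c) (≤-trans 3≤∣X∣ ∣X∣≤k)) , a∉D , Y⊆D

      separable : Shape Y → Separable X
      separable (none ∅) = none-separable ∅
      separable (one y∈Y Y⊆y) = One.one-separable y∈Y Y⊆y
      separable (two b∈Y c∈Y b≢c Y⊆bc) = Pair.pair-separable b∈Y c∈Y b≢c Y⊆bc
      separable (many 3≤∣Y∣) = many-separable 3≤∣Y∣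

    truncation-step : ∀ {X x₀} → Face X → ∣ X ∣ ≤ k → x₀ ∈ X → Separable X
    truncation-step faceX ∣X∣≤k x₀∈X with flatPeeling faceX
    ... | done ∅ = ⊥-elim (∅ (_ , x₀∈X))
    ... | peel a∈X (Z , flatZ , a∉Z , Y⊆Z) _ = Step.separable faceX ∣X∣≤k a∈X flatZ a∉Z Y⊆Z (shape _)

proposition4p3 : ∀ (n : ℕ) → 1 ≤ n → n ≤ 5 →
    (S : SimplicialComplex n) → IsTBRSC S → IsBRSC S
proposition4p3 zero () _ _ _
proposition4p3 (suc n) _ n≤5 S (S′ , k , (_ , M , H′⇔) , 1≤k , trunc) =
  flatPeelings⇒isBRSC S zero H? (peeling-of-steps (H S) (down-closed S) step)
  where
  H′? : ∀ X → Dec (H S′ X)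
  H′? = represented-decidable S′ M H′⇔
  open BooleanRepresentable S′ H′? (represented-flatPeeling S′ M H′⇔)
  open Truncation n≤5 k 1≤k

  H? : ∀ X → Dec (H S X)
  H? X = map′ (Equivalence.from (trunc X)) (Equivalence.to (trunc X)) (H′? X ×-dec ∣ X ∣ ≤? k)

  step : ∀ {X x₀} → H S X → x₀ ∈ X → ∃ λ x → x ∈ X × FlatSeparates (H S) x (X - x)
  step face x₀∈X with Equivalence.to (trunc _) face
  ... | face′ , ∣X∣≤k with truncation-step face′ ∣X∣≤k x₀∈X
  ... | x , x∈X , separates = x , x∈X , smallFlatSeparates⇒flatSeparates {k = k} {S} {S′} trunc separates
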